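{- Let $G$ be a finite simple graph. If $x$ is a construction sequence for $G$ with $\nu(x)=\nu_*(G)$, then $x$ is greedy.
   Context: For a finite simple graph $G=(V,E)$ with $p=|V|$, $q=|E|$, $\ell=p+q$, a construction sequence (c-sequence) for $G$ is a bijection $x:\{1,\dots,\ell\}\to V\sqcup E$ such that for every edge $e=uw$, $x^{ -1}(e)>\max\{x^{ -1}(u),x^{ -1}(w)\}$. The cost of an edge $e=uw$ in $x$ is $\nu(e,x)=(x^{ -1}(e)-x^{ -1}(u))+(x^{ -1}(e)-x^{ -1}(w))$, and the cost of $x$ is $\nu(x)=\sum_{e\in E}\nu(e,x)$. The min cost is $\nu_*(G)=\min\nu(x)$ over all c-sequences $x$ for $G$. A c-sequence $x$ is greedy if for every edge $e=uw$ and every vertex $v\notin\{u,w\}$, either $x^{ -1}(v)<\max\{x^{ -1}(u),x^{ -1}(w)\}$ or $x^{ -1}(v)>x^{ -1}(e)$. -}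

module Defs where

open import Data.Nat using (ℕ; _+_; _∸_; _<_; _≤_; _⊔_)
open import Data.Fin using (Fin; toℕ)
open import Data.List using (map; allFin)
open import Data.Nat.ListAction using (sum)
open import Data.Sum using (_⊎_; inj₁; inj₂)
open import Data.Product using (_×_)
open import Function.Bundles using (_↔_; Inverse)
open import Relation.Binary.PropositionalEquality using (_≡_; _≢_)

record SimpleGraph : Set where
  field
    p : ℕ
    q : ℕ
    end₁ : Fin q → Fin p
    end₂ : Fin q → Fin p
    loopless : ∀ e → end₁ e ≢ end₂ e
    noParallel : ∀ e f →
      (end₁ e ≡ end₁ f × end₂ e ≡ end₂ f) ⊎ (end₁ e ≡ end₂ f × end₂ e ≡ end₁ f) →
      e ≡ f

open SimpleGraph public

Elem : SimpleGraph → Set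
Elem G = Fin (p G) ⊎ Fin (q G)

len : SimpleGraph → ℕ
len G = p G + q G

-- A bijection x : {positions} → V ⊔ E (positions are 0..ℓ-1 instead of 1..ℓ;
-- all costs are differences of positions, so this is immaterial).
Seq : SimpleGraph → Set
Seq G = Fin (len G) ↔ Elem G

pos : (G : SimpleGraph) → Seq G → Elem G → ℕ
pos G x a = toℕ (Inverse.from x a)

posV : (G : SimpleGraph) → Seq G → Fin (p G) → ℕ
posV G x v = pos G x (inj₁ v)

posE : (G : SimpleGraph) → Seq G → Fin (q G) → ℕ
posE G x e = pos G x (inj₂ e)

IsCSeq : (G : SimpleGraph) → Seq G → Set
IsCSeq G x = ∀ e → (posV G x (end₁ G e) ⊔ posV G x (end₂ G e)) < posE G x e

-- cost of an edge (truncated subtraction is exact for c-sequences)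
edgeCost : (G : SimpleGraph) → Seq G → Fin (q G) → ℕ
edgeCost G x e = (posE G x e ∸ posV G x (end₁ G e)) + (posE G x e ∸ posV G x (end₂ G e))

cost : (G : SimpleGraph) → Seq G → ℕ
cost G x = sum (map (edgeCost G x) (allFin (q G)))

HasMinCost : (G : SimpleGraph) → Seq G → Set
HasMinCost G x = IsCSeq G x × (∀ y → IsCSeq G y → cost G x ≤ cost G y)

IsGreedy : (G : SimpleGraph) → Seq G → Set
IsGreedy G x = ∀ (e : Fin (q G)) (v : Fin (p G)) →
  v ≢ end₁ G e → v ≢ end₂ G e →
  (posV G x v < (posV G x (end₁ G e) ⊔ posV G x (end₂ G e))) ⊎ (posE G x e < posV G x v)

-- Suppose a vertex v sits strictly between the later endpoint of an edge e and e
-- itself, and let a be the element immediately before e; swap a and e.  If a is a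
-- vertex, the result is still a construction sequence, e becomes 2 cheaper and no
-- other edge becomes dearer, contradicting minimality.  If a is an edge, the swap
-- merely moves 2 units of cost from e to a, so the new sequence is again of minimal
-- cost while e has moved one step towards v; after finitely many steps the element
-- before e is a vertex.

module Submission where

open import Defs
open import Data.Empty using (⊥; ⊥-elim)
open import Data.Fin as Fin using (Fin; toℕ)
open import Data.Fin.Properties using (toℕ-injective; toℕ-inject₁; suc-injective)
  renaming (_≟_ to _≟ᶠ_)
open import Data.Fin.Permutation using (transpose)
import Data.Fin.Permutation.Components as PC
open import Data.List using (map; allFin)
open import Data.List.Properties using (map-tabulate)
open import Data.Nat using (ℕ; zero; suc; _+_; _∸_; _<_; _≤_; _⊔_; z≤n; _<?_)
open import Data.Nat.ListAction using (sum)
open import Data.Nat.Properties hiding (suc-injective)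
open import Algebra.Properties.CommutativeSemigroup +-commutativeSemigroup
  using (xy∙z≈xz∙y)
open import Data.Product using (_×_; _,_; Σ-syntax)
open import Data.Sum using (inj₁; inj₂)
open import Data.Sum.Properties using (inj₁-injective; inj₂-injective)
open import Function.Base using (id; _∘_; case_of_)
open import Function.Bundles using (_↔_; Inverse)
open import Function.Construct.Composition using (_↔-∘_)
open import Relation.Nullary using (¬_; yes; no)
open import Relation.Nullary.Decidable using (map′; dec-true; dec-false)
open import Relation.Binary.Definitions using (DecidableEquality)
open import Relation.Binary.PropositionalEquality

∑ : ∀ {n} → (Fin n → ℕ) → ℕ
∑ f = sum (map f (allFin _))

∑-suc : ∀ {n} (f : Fin (suc n) → ℕ) → ∑ f ≡ f Fin.zero + ∑ (f ∘ Fin.suc)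
∑-suc f = cong (λ fs → f Fin.zero + sum fs)
  (trans (map-tabulate Fin.suc f) (sym (map-tabulate id (f ∘ Fin.suc))))

∑-mono-≤ : ∀ {n} {f h : Fin n → ℕ} → (∀ i → f i ≤ h i) → ∑ f ≤ ∑ h
∑-mono-≤ {zero}          _   = z≤n
∑-mono-≤ {suc n} {f} {h} f≤h = begin
  ∑ f                          ≡⟨ ∑-suc f ⟩
  f Fin.zero + ∑ (f ∘ Fin.suc) ≤⟨ +-mono-≤ (f≤h Fin.zero) (∑-mono-≤ (f≤h ∘ Fin.suc)) ⟩
  h Fin.zero + ∑ (h ∘ Fin.suc) ≡⟨ ∑-suc h ⟨
  ∑ h                          ∎
  where open ≤-Reasoning

∑-mono-≤-except : ∀ {n} {f h : Fin n → ℕ} {c d} (i : Fin n) →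
  f i + c ≤ h i + d → (∀ j → j ≢ i → f j ≤ h j) → ∑ f + c ≤ ∑ h + d
∑-mono-≤-except {suc n} {f} {h} {c} {d} Fin.zero f₀+c≤h₀+d f≤h = begin
  ∑ f + c       ≡⟨ cong (_+ c) (∑-suc f) ⟩
  f₀ + ∑f′ + c  ≡⟨ xy∙z≈xz∙y f₀ ∑f′ c ⟩
  f₀ + c + ∑f′  ≤⟨ +-mono-≤ f₀+c≤h₀+d (∑-mono-≤ λ j → f≤h (Fin.suc j) λ ()) ⟩
  h₀ + d + ∑h′  ≡⟨ xy∙z≈xz∙y h₀ ∑h′ d ⟨
  h₀ + ∑h′ + d  ≡⟨ cong (_+ d) (∑-suc h) ⟨
  ∑ h + d       ∎
  where
  open ≤-Reasoning
  f₀ ∑f′ h₀ ∑h′ : ℕ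
  f₀ = f Fin.zero; ∑f′ = ∑ (f ∘ Fin.suc); h₀ = h Fin.zero; ∑h′ = ∑ (h ∘ Fin.suc)
∑-mono-≤-except {suc n} {f} {h} {c} {d} (Fin.suc i) fᵢ+c≤hᵢ+d f≤h = begin
  ∑ f + c         ≡⟨ cong (_+ c) (∑-suc f) ⟩
  f₀ + ∑f′ + c    ≡⟨ +-assoc f₀ ∑f′ c ⟩
  f₀ + (∑f′ + c)  ≤⟨ +-mono-≤ (f≤h Fin.zero λ ()) rest ⟩
  h₀ + (∑h′ + d)  ≡⟨ +-assoc h₀ ∑h′ d ⟨
  h₀ + ∑h′ + d    ≡⟨ cong (_+ d) (∑-suc h) ⟨
  ∑ h + d         ∎
  where
  open ≤-Reasoning
  f₀ ∑f′ h₀ ∑h′ : ℕ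
  f₀ = f Fin.zero; ∑f′ = ∑ (f ∘ Fin.suc); h₀ = h Fin.zero; ∑h′ = ∑ (h ∘ Fin.suc)
  rest : ∑f′ + c ≤ ∑h′ + d
  rest = ∑-mono-≤-except i fᵢ+c≤hᵢ+d λ j j≢i → f≤h (Fin.suc j) (j≢i ∘ suc-injective)

∑-mono-≤-transfer : ∀ {n} {f h : Fin n → ℕ} {c} {i j : Fin n} → i ≢ j →
  f i + c ≤ h i → f j ≤ h j + c → (∀ k → k ≢ i → k ≢ j → f k ≤ h k) → ∑ f ≤ ∑ h
∑-mono-≤-transfer {i = Fin.zero} {Fin.zero} i≢j _ _ _ = ⊥-elim (i≢j refl)
∑-mono-≤-transfer {suc n} {f} {h} {c} {Fin.zero} {Fin.suc j} _ f₀+c≤h₀ fⱼ≤hⱼ+c f≤h =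
  +-cancelʳ-≤ c _ _ (begin
    ∑ f + c         ≡⟨ cong (_+ c) (∑-suc f) ⟩
    f₀ + ∑f′ + c    ≡⟨ xy∙z≈xz∙y f₀ ∑f′ c ⟩
    f₀ + c + ∑f′    ≤⟨ +-mono-≤ f₀+c≤h₀ rest ⟩
    h₀ + (∑h′ + c)  ≡⟨ +-assoc h₀ ∑h′ c ⟨
    h₀ + ∑h′ + c    ≡⟨ cong (_+ c) (∑-suc h) ⟨
    ∑ h + c         ∎)
  where
  open ≤-Reasoning
  f₀ ∑f′ h₀ ∑h′ : ℕ
  f₀ = f Fin.zero; ∑f′ = ∑ (f ∘ Fin.suc); h₀ = h Fin.zero; ∑h′ = ∑ (h ∘ Fin.suc)
  rest : ∑f′ ≤ ∑h′ + c
  rest = subst (_≤ ∑h′ + c) (+-identityʳ ∑f′)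
    (∑-mono-≤-except j (subst (_≤ _) (sym (+-identityʳ _)) fⱼ≤hⱼ+c)
      λ k k≢j → f≤h (Fin.suc k) (λ ()) (k≢j ∘ suc-injective))
∑-mono-≤-transfer {suc n} {f} {h} {c} {Fin.suc i} {Fin.zero} _ fᵢ+c≤hᵢ f₀≤h₀+c f≤h =
  +-cancelʳ-≤ c _ _ (begin
    ∑ f + c         ≡⟨ cong (_+ c) (∑-suc f) ⟩
    f₀ + ∑f′ + c    ≡⟨ +-assoc f₀ ∑f′ c ⟩
    f₀ + (∑f′ + c)  ≤⟨ +-mono-≤ f₀≤h₀+c rest ⟩
    h₀ + c + ∑h′    ≡⟨ xy∙z≈xz∙y h₀ ∑h′ c ⟨
    h₀ + ∑h′ + c    ≡⟨ cong (_+ c) (∑-suc h) ⟨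
    ∑ h + c         ∎)
  where
  open ≤-Reasoning
  f₀ ∑f′ h₀ ∑h′ : ℕ
  f₀ = f Fin.zero; ∑f′ = ∑ (f ∘ Fin.suc); h₀ = h Fin.zero; ∑h′ = ∑ (h ∘ Fin.suc)
  rest : ∑f′ + c ≤ ∑h′
  rest = subst (∑f′ + c ≤_) (+-identityʳ ∑h′)
    (∑-mono-≤-except i (subst (_ ≤_) (sym (+-identityʳ _)) fᵢ+c≤hᵢ)
      λ k k≢i → f≤h (Fin.suc k) (k≢i ∘ suc-injective) (λ ()))
∑-mono-≤-transfer {suc n} {f} {h} {i = Fin.suc i} {Fin.suc j} i≢j fᵢ+c≤hᵢ fⱼ≤hⱼ+c f≤h =
  subst₂ _≤_ (sym (∑-suc f)) (sym (∑-suc h))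
    (+-mono-≤ (f≤h Fin.zero (λ ()) (λ ()))
      (∑-mono-≤-transfer (i≢j ∘ cong Fin.suc) fᵢ+c≤hᵢ fⱼ≤hⱼ+c
        λ k k≢i k≢j → f≤h (Fin.suc k) (k≢i ∘ suc-injective) (k≢j ∘ suc-injective)))

suc-∸-+-suc-∸ : ∀ {t u w} → u ≤ t → w ≤ t → (suc t ∸ u) + (suc t ∸ w) ≡ 2 + ((t ∸ u) + (t ∸ w))
suc-∸-+-suc-∸ {t} {u} {w} u≤t w≤t = begin
  (suc t ∸ u) + (suc t ∸ w)  ≡⟨ cong₂ _+_ (+-∸-assoc 1 u≤t) (+-∸-assoc 1 w≤t) ⟩
  suc (t ∸ u) + suc (t ∸ w)  ≡⟨ cong suc (+-suc (t ∸ u) (t ∸ w)) ⟩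
  2 + ((t ∸ u) + (t ∸ w))    ∎
  where open ≡-Reasoning

transpose-matchˡ : ∀ {n} (i j : Fin n) → PC.transpose i j i ≡ j
transpose-matchˡ i j rewrite dec-true (i ≟ᶠ i) refl = refl

transpose-matchʳ : ∀ {n} (i j : Fin n) → PC.transpose i j j ≡ i
transpose-matchʳ i j with j ≟ᶠ i
... | yes j≡i = j≡i
... | no  _   rewrite dec-true (j ≟ᶠ j) refl = refl

transpose-other : ∀ {n} {i j k : Fin n} → k ≢ i → k ≢ j → PC.transpose i j k ≡ k
transpose-other {i = i} {j} {k} k≢i k≢j
  rewrite dec-false (k ≟ᶠ i) k≢i | dec-false (k ≟ᶠ j) k≢j = refl

module _ {n : ℕ} {A : Set} (x : Fin n ↔ A) where
  open Inverse x

  from-injective : ∀ {c d} → from c ≡ from d → c ≡ d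
  from-injective {c} {d} eq = begin
    c           ≡⟨ strictlyInverseˡ c ⟨
    to (from c) ≡⟨ cong to eq ⟩
    to (from d) ≡⟨ strictlyInverseˡ d ⟩
    d           ∎
    where open ≡-Reasoning

  rank : A → ℕ
  rank c = toℕ (from c)

  rank-injective : ∀ {c d} → rank c ≡ rank d → c ≡ d
  rank-injective = from-injective ∘ toℕ-injective

  ≡-dec : DecidableEquality A
  ≡-dec c d = map′ from-injective (cong from) (from c ≟ᶠ from d)

  rank-<⇒≢ : ∀ {c d} → rank c < rank d → c ≢ d
  rank-<⇒≢ c<d refl = <-irrefl refl c<d

  predecessor : ∀ c → 0 < rank c → Σ[ a ∈ A ] suc (rank a) ≡ rank c
  predecessor c 0<c = to (Fin.pred (from c)) ,
    trans (cong (suc ∘ toℕ) (strictlyInverseʳ _)) (suc-toℕ-pred (from c) 0<c)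
    where
    suc-toℕ-pred : ∀ {m} (i : Fin m) → 0 < toℕ i → suc (toℕ (Fin.pred i)) ≡ toℕ i
    suc-toℕ-pred (Fin.suc i) _ = cong suc (toℕ-inject₁ i)

  swap : A → A → Fin n ↔ A
  swap a b = x ↔-∘ transpose (from a) (from b)

module _ {n : ℕ} {A : Set} (x : Fin n ↔ A) {a b : A} where
  private
    y : Fin n ↔ A
    y = swap x a b

  rank-swapˡ : rank y a ≡ rank x b
  rank-swapˡ = cong toℕ (transpose-matchʳ (Inverse.from x b) (Inverse.from x a))

  rank-swapʳ : rank y b ≡ rank x a
  rank-swapʳ = cong toℕ (transpose-matchˡ (Inverse.from x b) (Inverse.from x a))

  rank-swap-other : ∀ {c} → c ≢ a → c ≢ b → rank y c ≡ rank x c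
  rank-swap-other c≢a c≢b =
    cong toℕ (transpose-other (c≢b ∘ from-injective x) (c≢a ∘ from-injective x))

  module _ (adjacent : suc (rank x a) ≡ rank x b) where

    a<b : rank x a < rank x b
    a<b = ≤-reflexive adjacent

    rank-swap-mono : ∀ {c} → c ≢ b → rank x c ≤ rank y c
    rank-swap-mono {c} c≢b with ≡-dec x c a
    ... | yes refl = ≤-trans (n≤1+n _) (≤-reflexive (trans adjacent (sym rank-swapˡ)))
    ... | no  c≢a  = ≤-reflexive (sym (rank-swap-other c≢a c≢b))

    rank-swap-preserves-< : ∀ {c d} → rank x c < rank x d → ¬ (c ≡ a × d ≡ b) →
                            rank y c < rank y d
    rank-swap-preserves-< {c} {d} c<d c,d≢a,b with ≡-dec x c a | ≡-dec x c b
    ... | yes refl | _ = begin-strict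
      rank y a ≡⟨ rank-swapˡ ⟩
      rank x b <⟨ ≤∧≢⇒< (subst (_≤ rank x d) adjacent c<d) (d≢b ∘ sym ∘ rank-injective x) ⟩
      rank x d ≡⟨ rank-swap-other d≢a d≢b ⟨
      rank y d ∎
      where
      open ≤-Reasoning
      d≢a : d ≢ a
      d≢a = rank-<⇒≢ x c<d ∘ sym
      d≢b : d ≢ b
      d≢b d≡b = c,d≢a,b (refl , d≡b)
    ... | no _ | yes refl = begin-strict
      rank y b ≡⟨ rank-swapʳ ⟩
      rank x a <⟨ a<b ⟩
      rank x b <⟨ c<d ⟩
      rank x d ≡⟨ rank-swap-other (rank-<⇒≢ x (<-trans a<b c<d) ∘ sym) (rank-<⇒≢ x c<d ∘ sym) ⟨
      rank y d ∎
      where open ≤-Reasoning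
    ... | no c≢a | no c≢b rewrite rank-swap-other c≢a c≢b with ≡-dec x d a | ≡-dec x d b
    ...   | yes refl | _ = subst (rank x c <_) (sym rank-swapˡ) (<-trans c<d a<b)
    ...   | no _ | yes refl = subst (rank x c <_) (sym rank-swapʳ)
      (≤∧≢⇒< (≤-pred (subst (rank x c <_) (sym adjacent) c<d)) (c≢a ∘ rank-injective x))
    ...   | no d≢a | no d≢b = subst (rank x c <_) (sym (rank-swap-other d≢a d≢b)) c<d

module _ (G : SimpleGraph) where

  lastEnd : Seq G → Fin (q G) → ℕ
  lastEnd x e = posV G x (end₁ G e) ⊔ posV G x (end₂ G e)

  lastEnd≢posV : ∀ x e v → v ≢ end₁ G e → v ≢ end₂ G e → lastEnd x e ≢ posV G x v
  lastEnd≢posV x e v v≢u₁ v≢u₂ eq with ⊔-sel (posV G x (end₁ G e)) (posV G x (end₂ G e))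
  ... | inj₁ ⊔≡u₁ = v≢u₁ (inj₁-injective (rank-injective x (trans (sym eq) ⊔≡u₁)))
  ... | inj₂ ⊔≡u₂ = v≢u₂ (inj₁-injective (rank-injective x (trans (sym eq) ⊔≡u₂)))

  lastEnd<⇒end₁< : ∀ x e {t} → lastEnd x e < t → posV G x (end₁ G e) < t
  lastEnd<⇒end₁< x e = m⊔n<o⇒m<o (posV G x (end₁ G e)) (posV G x (end₂ G e))

  lastEnd<⇒end₂< : ∀ x e {t} → lastEnd x e < t → posV G x (end₂ G e) < t
  lastEnd<⇒end₂< x e = m⊔n<o⇒n<o (posV G x (end₁ G e)) (posV G x (end₂ G e))

  module EdgeAdvance (x : Seq G) (x-cseq : IsCSeq G x) (e : Fin (q G)) (a : Elem G)
         (adjacent : suc (pos G x a) ≡ posE G x e) (ends<a : lastEnd x e < pos G x a) where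

    y : Seq G
    y = swap x a (inj₂ e)

    posE-advanced : posE G y e ≡ pos G x a
    posE-advanced = rank-swapʳ x

    end-fixed : ∀ {u} → posV G x u < pos G x a → posV G y u ≡ posV G x u
    end-fixed u<a = rank-swap-other x (rank-<⇒≢ x u<a) (λ ())

    u₁<a : posV G x (end₁ G e) < pos G x a
    u₁<a = lastEnd<⇒end₁< x e ends<a

    u₂<a : posV G x (end₂ G e) < pos G x a
    u₂<a = lastEnd<⇒end₂< x e ends<a

    lastEnd-fixed : lastEnd y e ≡ lastEnd x e
    lastEnd-fixed = cong₂ _⊔_ (end-fixed u₁<a) (end-fixed u₂<a)

    isCSeq : IsCSeq G y
    isCSeq g = ⊔-pres-<m (stays (lastEnd<⇒end₁< x g (x-cseq g)) λ { refl → u₁<a })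
                         (stays (lastEnd<⇒end₂< x g (x-cseq g)) λ { refl → u₂<a })
      where
      stays : ∀ {u} → posV G x u < posE G x g → (g ≡ e → posV G x u < pos G x a) →
              posV G y u < posE G y g
      stays u<g u<a-if-e = rank-swap-preserves-< x adjacent u<g
        λ (u≡a , g≡e) → rank-<⇒≢ x (u<a-if-e (inj₂-injective g≡e)) u≡a

    edgeCost-advanced : edgeCost G y e + 2 ≡ edgeCost G x e
    edgeCost-advanced rewrite posE-advanced | end-fixed u₁<a | end-fixed u₂<a | sym adjacent =
      trans (+-comm _ 2) (sym (suc-∸-+-suc-∸ (<⇒≤ u₁<a) (<⇒≤ u₂<a)))

    edgeCost-other : ∀ {g} → g ≢ e → inj₂ g ≢ a → edgeCost G y g ≤ edgeCost G x g
    edgeCost-other g≢e g≢a rewrite rank-swap-other x g≢a (g≢e ∘ inj₂-injective) =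
      +-mono-≤ (∸-monoʳ-≤ _ (rank-swap-mono x adjacent λ ()))
               (∸-monoʳ-≤ _ (rank-swap-mono x adjacent λ ()))

    posE-delayed : ∀ {f} → inj₂ f ≡ a → posE G y f ≡ suc (posE G x f)
    posE-delayed {f} f≡a = begin
      posE G y f        ≡⟨ cong (pos G y) f≡a ⟩
      pos G y a         ≡⟨ rank-swapˡ x ⟩
      posE G x e        ≡⟨ adjacent ⟨
      suc (pos G x a)   ≡⟨ cong (suc ∘ pos G x) f≡a ⟨
      suc (posE G x f)  ∎
      where open ≡-Reasoning

    vertices-fixed : ∀ {f} → inj₂ f ≡ a → ∀ u → posV G y u ≡ posV G x u
    vertices-fixed f≡a u = rank-swap-other x (λ u≡a → case trans u≡a (sym f≡a) of λ ()) (λ ())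

    edgeCost-delayed : ∀ {f} → inj₂ f ≡ a → edgeCost G y f ≡ edgeCost G x f + 2
    edgeCost-delayed {f} f≡a
      rewrite posE-delayed f≡a | vertices-fixed f≡a (end₁ G f) | vertices-fixed f≡a (end₂ G f) =
      trans (suc-∸-+-suc-∸ (<⇒≤ (lastEnd<⇒end₁< x f (x-cseq f)))
                           (<⇒≤ (lastEnd<⇒end₂< x f (x-cseq f))))
            (+-comm 2 _)

    cost-advance-vertex : (∀ f → inj₂ f ≢ a) → cost G y + 2 ≤ cost G x
    cost-advance-vertex a-vertex = subst (cost G y + 2 ≤_) (+-identityʳ (cost G x))
      (∑-mono-≤-except e (≤-reflexive (trans edgeCost-advanced (sym (+-identityʳ _))))
        λ g g≢e → edgeCost-other g≢e (a-vertex g))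

    cost-advance-edge : ∀ {f} → inj₂ f ≡ a → cost G y ≤ cost G x
    cost-advance-edge {f} f≡a =
      ∑-mono-≤-transfer e≢f (≤-reflexive edgeCost-advanced) (≤-reflexive (edgeCost-delayed f≡a))
        λ g g≢e g≢f → edgeCost-other g≢e (g≢f ∘ inj₂-injective ∘ λ g≡a → trans g≡a (sym f≡a))
      where
      e≢f : e ≢ f
      e≢f e≡f = rank-<⇒≢ x (≤-reflexive adjacent) (trans (sym f≡a) (cong inj₂ (sym e≡f)))

  no-vertex-between : ∀ n (x : Seq G) → HasMinCost G x → ∀ e v →
    lastEnd x e < posV G x v → posV G x v < posE G x e → posE G x e ≤ n + posV G x v → ⊥
  no-vertex-between zero    x _ e v _ v<e e≤v = <⇒≱ v<e e≤v
  no-vertex-between (suc n) x (x-cseq , x-cost≤) e v ends<v v<e e≤1+n+v =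
    let a , adjacent = predecessor x (inj₂ e) (≤-<-trans z≤n v<e)
    in step a adjacent (≤-pred (subst (posV G x v <_) (sym adjacent) v<e))
    where
    step : (a : Elem G) → suc (pos G x a) ≡ posE G x e → posV G x v ≤ pos G x a → ⊥
    step (inj₁ w) adjacent v≤w =
      m+1+n≰m (cost G y) (≤-trans (cost-advance-vertex λ _ ()) (x-cost≤ y isCSeq))
      where open EdgeAdvance x x-cseq e (inj₁ w) adjacent (<-≤-trans ends<v v≤w)
    step (inj₂ f) adjacent v≤f =
      no-vertex-between n y y-min e v
        (subst₂ _<_ (sym lastEnd-fixed) (sym v-fixed) ends<v)
        (subst₂ _<_ (sym v-fixed) (sym posE-advanced) v<f)
        (subst₂ _≤_ (sym posE-advanced) (cong (n +_) (sym v-fixed)) f≤n+v)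
      where
      open EdgeAdvance x x-cseq e (inj₂ f) adjacent (<-≤-trans ends<v v≤f)
      y-min : HasMinCost G y
      y-min = isCSeq , λ z z-cseq → ≤-trans (cost-advance-edge refl) (x-cost≤ z z-cseq)
      v-fixed : posV G y v ≡ posV G x v
      v-fixed = vertices-fixed refl v
      v<f : posV G x v < posE G x f
      v<f = ≤∧≢⇒< v≤f (λ v≡f → case rank-injective x v≡f of λ ())
      f≤n+v : posE G x f ≤ n + posV G x v
      f≤n+v = ≤-pred (subst (_≤ suc n + posV G x v) (sym adjacent) e≤1+n+v)

lemma1 : (G : SimpleGraph) (x : Seq G) → HasMinCost G x → IsGreedy G x
lemma1 G x x-min e v v≢u₁ v≢u₂ with posV G x v <? lastEnd G x e | posE G x e <? posV G x v
... | yes v<ends | _       = inj₁ v<ends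
... | no _       | yes e<v = inj₂ e<v
... | no v≮ends  | no e≮v  =
  ⊥-elim (no-vertex-between G (posE G x e) x x-min e v ends<v v<e (m≤m+n _ _))
  where
  ends<v : lastEnd G x e < posV G x v
  ends<v = ≤∧≢⇒< (≮⇒≥ v≮ends) (lastEnd≢posV G x e v v≢u₁ v≢u₂)
  v<e : posV G x v < posE G x e
  v<e = ≤∧≢⇒< (≮⇒≥ e≮v) (λ v≡e → case rank-injective x v≡e of λ ())
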